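{- Let $k\geq 1$ and $n\geq 2k+1$. If the Kneser graph $K(n,k)$ admits a Hamilton cycle, then the bipartite Kneser graph $H(n,k)$ admits a Hamilton cycle or a Hamilton path.
   Context: The Kneser graph $K(n,k)$ has as vertices all $k$-element subsets of $[n]$, two sets being adjacent iff they are disjoint. The bipartite Kneser graph $H(n,k)$ has as vertices all $k$-element and all $(n-k)$-element subsets of $[n]$, with an edge between $A$ and $B$ if and only if $A\subseteq B$. -}

module Defs where

open import Level using (Level)
open import Data.Nat using (ℕ; _∸_; _≤_; _+_)
open import Data.Fin using (Fin; zero; suc; toℕ; fromℕ<; inject₁)
open import Data.Fin.Subset using (Subset; ∣_∣; _⊆_; Empty; _∩_)
open import Data.Product using (Σ; _×_; _,_)
open import Data.Sum using (_⊎_; inj₁; inj₂)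
open import Relation.Binary.PropositionalEquality using (_≡_)
open import Function.Bundles using (_⤖_; Bijection)
open import Data.Empty using (⊥)

record Graph : Set₁ where
  field
    Vertex : Set
    Adj    : Vertex → Vertex → Set
open Graph public

KSet : ℕ → ℕ → Set
KSet n k = Σ (Subset n) (λ A → ∣ A ∣ ≡ k)

Kneser : ℕ → ℕ → Graph
Kneser n k = record
  { Vertex = KSet n k
  ; Adj    = λ { (A , _) (B , _) → Empty (A ∩ B) } }

BipKneser : ℕ → ℕ → Graph
BipKneser n k = record
  { Vertex = KSet n k ⊎ KSet n (n ∸ k)
  ; Adj    = adj }
  where
  adj : KSet n k ⊎ KSet n (n ∸ k) → KSet n k ⊎ KSet n (n ∸ k) → Set
  adj (inj₁ (A , _)) (inj₂ (B , _)) = A ⊆ B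
  adj (inj₂ (B , _)) (inj₁ (A , _)) = A ⊆ B
  adj _ _ = ⊥

record HamiltonPath (G : Graph) : Set where
  field
    len  : ℕ
    walk : Fin len ⤖ Vertex G
    step : (i : Fin len) (j : Fin len) → toℕ j ≡ toℕ i + 1 →
           Adj G (Bijection.to walk i) (Bijection.to walk j)

record HamiltonCycle (G : Graph) : Set where
  field
    path  : HamiltonPath G
    three : 3 ≤ HamiltonPath.len path
    close : (i j : Fin (HamiltonPath.len path)) →
            toℕ i ≡ 0 → toℕ j + 1 ≡ HamiltonPath.len path →
            Adj G (Bijection.to (HamiltonPath.walk path) j)
                  (Bijection.to (HamiltonPath.walk path) i)

{-# OPTIONS --safe #-}
-- H(n,k) is the bipartite double cover of K(n,k): each k-set A occurs as itself and as its
-- complement, and A, B disjoint means A ⊆ ∁ B. Lift a Hamilton cycle x₀ … x_{N-1} of K(n,k)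
-- by alternating between the two sheets. For odd N the lift only closes after two rounds and
-- is a Hamilton cycle of H(n,k). For even N it closes after one round, and the lifts starting
-- on either sheet partition H(n,k). Because n ≥ 2k+1, K(n,k) contains a closed walk of odd
-- length 2k+1, so colouring the xᵢ by the parity of i leaves an edge a—c with both ends of
-- equal parity; it joins the two lifts into a Hamilton path.
module Submission where

open import Data.Bool using (Bool; true; false; not; _xor_; _∧_; _∨_; T)
open import Data.Bool.Properties
  using (not-involutive; ¬-not; not-¬; not-distribˡ-xor; not-distribʳ-xor;
         xor-assoc; xor-comm; xor-same; xor-identityʳ; xor-inverseˡ; T-≡; T-∨)
  renaming (_≟_ to _≟ᵇ_)
open import Data.Empty using (⊥; ⊥-elim)
open import Data.Fin using (Fin; zero; suc; toℕ; fromℕ)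
open import Data.Fin.Properties using (toℕ-fromℕ)
open import Data.Fin.Subset using (Subset; ∣_∣; ∁; Empty; _∩_; _⊆_) renaming (_∈_ to _∈ₛ_)
open import Data.Fin.Subset.Properties
  using (drop-there; x∈p∩q⁻; x∈p∩q⁺; x∉p⇒x∈∁p; ∩-comm; ∣∁p∣≡n∸∣p∣)
open import Data.List using (List; []; _∷_; _++_; [_]; length; map; lookup; tabulate)
open import Data.List.Properties using (++-assoc; length-++; length-tabulate)
open import Data.List.Membership.Propositional using (_∈_)
open import Data.List.Membership.Propositional.Properties
  using (∈-map⁺; ∈-map⁻; ∈-++⁺ˡ; ∈-++⁺ʳ; ∈-∃++; ∈-lookup; ∈-tabulate⁺)
open import Data.List.Relation.Binary.Permutation.Propositional
  using (_↭_; ↭⇒↭ₛ; ↭-refl; ↭-sym; prep; swap; module PermutationReasoning)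
open import Data.List.Relation.Binary.Permutation.Propositional.Properties
  using (shift; ++-comm; ++⁺; ∈-resp-↭)
import Data.List.Relation.Binary.Permutation.Setoid.Properties as Setoid↭
import Data.List.Relation.Unary.All as All
open import Data.List.Relation.Unary.AllPairs using (_∷_)
open import Data.List.Relation.Unary.Any using (index)
open import Data.List.Relation.Unary.Any.Properties using (lookup-index)
open import Data.List.Relation.Unary.Unique.Propositional using (Unique)
import Data.List.Relation.Unary.Unique.Propositional.Properties as Unique
open import Data.Nat using (ℕ; zero; suc; _+_; _*_; _∸_; _≤_; _<_; _<ᵇ_; z≤n; s≤s)
open import Data.Nat.Properties
  using (≤-refl; ≤-reflexive; ≤-trans; <⇒≤; <⇒≱; ≮⇒≥; <⇒<ᵇ; <ᵇ⇒<; n≤1+n; m≤m+n; m≤n+m;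
         +-comm; +-suc; +-identityʳ; +-monoʳ-≤; +-monoˡ-≤; suc-injective; ≡-irrelevant;
         m+n∸m≡n; m+[n∸m]≡n; m∸[m∸n]≡n; [m+n]∸[m+o]≡n∸o)
open import Data.Product using (Σ; ∃₂; _×_; _,_; proj₁; proj₂; map₁)
open import Data.Sum using (_⊎_; inj₁; inj₂)
import Data.Sum as Sum
open import Data.Sum.Properties using (inj₁-injective; inj₂-injective)
open import Data.Unit using (⊤; tt)
open import Data.Vec using ([]; _∷_)
open import Data.Vec.Properties using ([]=⇒lookup; map-∘; map-cong; map-id)
open import Function using (_∘_)
open import Function.Bundles
  using (_↔_; _⤖_; Equivalence; Inverse; Injection; Bijection; mk⤖; mk↔ₛ′)
open import Function.Properties.Inverse using (↔⇒↣)
open import Relation.Binary.PropositionalEquality hiding ([_])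
open import Relation.Nullary using (¬_; yes; no; contradiction)

open import Defs

private variable
  A : Set
  R : A → A → Set

Walk : (A → A → Set) → A → List A → Set
Walk R x []       = ⊤
Walk R x (y ∷ ys) = R x y × Walk R y ys

end : A → List A → A
end x []       = x
end x (y ∷ ys) = end y ys

ClosedWalk : (A → A → Set) → A → List A → Set
ClosedWalk R x xs = Walk R x xs × end x xs ≡ x

end-++ : ∀ (x : A) xs ys → end x (xs ++ ys) ≡ end (end x xs) ys
end-++ x []       ys = refl
end-++ x (y ∷ xs) ys = end-++ y xs ys

Walk-++⁺ : ∀ {x : A} xs {ys} → Walk R x xs → Walk R (end x xs) ys → Walk R x (xs ++ ys)
Walk-++⁺ []       _       w = w
Walk-++⁺ (y ∷ xs) (r , v) w = r , Walk-++⁺ xs v w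

Walk-++⁻ : ∀ {x : A} xs {ys} → Walk R x (xs ++ ys) → Walk R x xs × Walk R (end x xs) ys
Walk-++⁻ []       w       = tt , w
Walk-++⁻ (y ∷ xs) (r , w) = map₁ (r ,_) (Walk-++⁻ xs w)

ClosedWalk-++ : ∀ {x : A} xs {ys} → ClosedWalk R x xs → ClosedWalk R x ys → ClosedWalk R x (xs ++ ys)
ClosedWalk-++ {R = R} {x} xs {ys} (v , back) (w , back′) =
  Walk-++⁺ xs v (subst (λ z → Walk R z ys) (sym back) w) ,
  trans (end-++ x xs ys) (trans (cong (λ z → end z ys) back) back′)

ClosedWalk-rotate : ∀ {x : A} xs ys → ClosedWalk R x (xs ++ ys) → ClosedWalk R (end x xs) (ys ++ xs)
ClosedWalk-rotate {R = R} {x} xs ys (w , back) =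
  Walk-++⁺ ys w₂ (subst (λ z → Walk R z xs) (sym back′) w₁) ,
  trans (end-++ (end x xs) ys xs) (cong (λ z → end z xs) back′)
  where
  w₁ = proj₁ (Walk-++⁻ xs w)
  w₂ = proj₂ (Walk-++⁻ xs w)
  back′ : end (end x xs) ys ≡ x
  back′ = trans (sym (end-++ x xs ys)) back

Walk-lookup : ∀ {x : A} {xs} → Walk R x xs → ∀ i j → toℕ j ≡ toℕ i + 1 → R (lookup xs i) (lookup xs j)
Walk-lookup {xs = _ ∷ _ ∷ _} (_ , r , _) zero    (suc zero)    _ = r
Walk-lookup {xs = _ ∷ _}     (_ , w)     (suc i) (suc j)       e = Walk-lookup w i j (suc-injective e)
Walk-lookup {xs = _ ∷ _}     _           zero    zero          ()
Walk-lookup {xs = _ ∷ _ ∷ _} _           zero    (suc (suc _)) ()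

Walk-lookup-head : ∀ {x : A} {xs} → Walk R x xs → ∀ i → toℕ i ≡ 0 → R x (lookup xs i)
Walk-lookup-head {xs = _ ∷ _} (r , _) zero _ = r

lookup-end : ∀ (x : A) xs i → toℕ i + 1 ≡ length xs → lookup xs i ≡ end x xs
lookup-end x (y ∷ [])     zero    _ = refl
lookup-end x (y ∷ z ∷ zs) zero    ()
lookup-end x (y ∷ ys)     (suc i) e = lookup-end y ys i (suc-injective e)

Walk-tabulate : ∀ {N} (f : Fin (suc N) → A) {x} → R x (f zero) →
                (∀ i j → toℕ j ≡ toℕ i + 1 → R (f i) (f j)) → Walk R x (tabulate f)
Walk-tabulate {N = zero}  f r _    = r , tt
Walk-tabulate {N = suc N} f r step =
  r , Walk-tabulate (f ∘ suc) (step zero (suc zero) refl) (λ i j e → step (suc i) (suc j) (cong suc e))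

end-tabulate : ∀ {N} (f : Fin (suc N) → A) x → end x (tabulate f) ≡ f (fromℕ N)
end-tabulate {N = zero}  f x = refl
end-tabulate {N = suc N} f x = end-tabulate (f ∘ suc) (f zero)

oddLength : List A → Bool
oddLength []       = false
oddLength (_ ∷ xs) = not (oddLength xs)

oddLength-++ : ∀ (xs ys : List A) → oddLength (xs ++ ys) ≡ oddLength xs xor oddLength ys
oddLength-++ []       ys = refl
oddLength-++ (_ ∷ xs) ys =
  trans (cong not (oddLength-++ xs ys)) (not-distribˡ-xor (oddLength xs) (oddLength ys))

oddLength-comm : ∀ (xs ys : List A) → oddLength (xs ++ ys) ≡ oddLength (ys ++ xs)
oddLength-comm xs ys = begin
  oddLength (xs ++ ys)              ≡⟨ oddLength-++ xs ys ⟩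
  oddLength xs xor oddLength ys     ≡⟨ xor-comm (oddLength xs) _ ⟩
  oddLength ys xor oddLength xs     ≡⟨ oddLength-++ ys xs ⟨
  oddLength (ys ++ xs)              ∎
  where open ≡-Reasoning

MonochromaticEdge : (A → A → Set) → (A → Bool) → Set
MonochromaticEdge R colour = ∃₂ λ x y → R x y × colour x ≡ colour y

NonBipartite : (A → A → Set) → Set
NonBipartite R = ∀ colour → MonochromaticEdge R colour

walk-monochromatic⊎alternating : ∀ (colour : A → Bool) {x} xs → Walk R x xs →
                                 MonochromaticEdge R colour ⊎ colour (end x xs) ≡ colour x xor oddLength xs
walk-monochromatic⊎alternating colour {x} []       _ = inj₂ (sym (xor-identityʳ (colour x)))
walk-monochromatic⊎alternating colour {x} (y ∷ ys) (r , w) with colour x ≟ᵇ colour y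
... | yes same  = inj₁ (x , y , r , same)
... | no differ = Sum.map₂ alternate (walk-monochromatic⊎alternating colour ys w)
  where
  alternate : colour (end y ys) ≡ colour y xor oddLength ys →
              colour (end y ys) ≡ colour x xor not (oddLength ys)
  alternate e = begin
    colour (end y ys)                  ≡⟨ e ⟩
    colour y xor oddLength ys          ≡⟨ cong (_xor oddLength ys) (¬-not (differ ∘ sym)) ⟩
    not (colour x) xor oddLength ys    ≡⟨ not-distribˡ-xor (colour x) _ ⟨
    not (colour x xor oddLength ys)    ≡⟨ not-distribʳ-xor (colour x) _ ⟩
    colour x xor not (oddLength ys)    ∎
    where open ≡-Reasoning

oddClosedWalk⇒nonBipartite : ∀ {x : A} xs → ClosedWalk R x xs → oddLength xs ≡ true → NonBipartite R
oddClosedWalk⇒nonBipartite {x = x} xs (w , back) odd colour with walk-monochromatic⊎alternating colour xs w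
... | inj₁ edge = edge
... | inj₂ e    = contradiction flipped (not-¬ refl)
  where
  flipped : colour x ≡ not (colour x)
  flipped = begin
    colour x                   ≡⟨ cong colour back ⟨
    colour (end x xs)          ≡⟨ e ⟩
    colour x xor oddLength xs  ≡⟨ cong (colour x xor_) odd ⟩
    colour x xor true          ≡⟨ xor-comm (colour x) true ⟩
    not (colour x)             ∎
    where open ≡-Reasoning

ListsEachOnce : List A → Set
ListsEachOnce {A} xs = Unique xs × (∀ (x : A) → x ∈ xs)

ListsEachOnce-resp-↭ : ∀ {xs ys : List A} → xs ↭ ys → ListsEachOnce xs → ListsEachOnce ys
ListsEachOnce-resp-↭ p (unique , complete) =
  Setoid↭.Unique-resp-↭ (setoid _) (↭⇒↭ₛ p) unique , λ x → ∈-resp-↭ p (complete x)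

-- `anchor` is adjacent to the first listed vertex; in a cycle it is also the last one.
record HamiltonPathList {A : Set} (R : A → A → Set) : Set where
  field
    anchor   : A
    vertices : List A
    eachOnce : ListsEachOnce vertices
    walk     : Walk R anchor vertices

record HamiltonCycleList {A : Set} (R : A → A → Set) : Set where
  field
    anchor     : A
    vertices   : List A
    eachOnce   : ListsEachOnce vertices
    closedWalk : ClosedWalk R anchor vertices
    three      : 3 ≤ length vertices

lookup-injective : ∀ {xs : List A} → Unique xs → ∀ {i j} → lookup xs i ≡ lookup xs j → i ≡ j
lookup-injective (_     ∷ _)      {zero}  {zero}  _ = refl
lookup-injective (fresh ∷ _)      {zero}  {suc j} e = contradiction e (All.lookup fresh (∈-lookup j))
lookup-injective (fresh ∷ _)      {suc i} {zero}  e = contradiction (sym e) (All.lookup fresh (∈-lookup i))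
lookup-injective (_     ∷ unique) {suc i} {suc j} e = cong suc (lookup-injective unique e)

lookup-⤖ : ∀ {xs : List A} → ListsEachOnce xs → Fin (length xs) ⤖ A
lookup-⤖ (unique , complete) =
  mk⤖ (lookup-injective unique , λ y → index (complete y) , λ { refl → sym (lookup-index (complete y)) })

module _ (G : Graph) where

  toHamiltonPath : HamiltonPathList (Adj G) → HamiltonPath G
  toHamiltonPath hp = record
    { len  = length vertices
    ; walk = lookup-⤖ eachOnce
    ; step = Walk-lookup walk
    }
    where open HamiltonPathList hp

  toHamiltonCycle : HamiltonCycleList (Adj G) → HamiltonCycle G
  toHamiltonCycle hc = record
    { path  = toHamiltonPath record
        { anchor = anchor ; vertices = vertices ; eachOnce = eachOnce ; walk = proj₁ closedWalk }
    ; three = three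
    ; close = λ i j first last →
        subst (λ z → Adj G z (lookup vertices i))
              (sym (trans (lookup-end anchor vertices j last) (proj₂ closedWalk)))
              (Walk-lookup-head (proj₁ closedWalk) i first)
    }
    where open HamiltonCycleList hc

  fromHamiltonCycle : HamiltonCycle G → HamiltonCycleList (Adj G)
  fromHamiltonCycle hc = listed len walk step close three
    where
    open HamiltonCycle hc
    open HamiltonPath path
    listed : ∀ N (W : Fin N ⤖ Vertex G) →
             (∀ i j → toℕ j ≡ toℕ i + 1 → Adj G (Bijection.to W i) (Bijection.to W j)) →
             (∀ i j → toℕ i ≡ 0 → toℕ j + 1 ≡ N → Adj G (Bijection.to W j) (Bijection.to W i)) →
             3 ≤ N → HamiltonCycleList (Adj G)
    listed (suc N) W step close three = record
      { anchor     = f (fromℕ N)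
      ; vertices   = tabulate f
      ; eachOnce   = Unique.tabulate⁺ {f = f} (Bijection.injective W) , complete
      ; closedWalk = Walk-tabulate f (close zero (fromℕ N) refl last) step , end-tabulate f (f (fromℕ N))
      ; three      = subst (3 ≤_) (sym (length-tabulate f)) three
      }
      where
      f = Bijection.to W
      last : toℕ (fromℕ N) + 1 ≡ suc N
      last = trans (cong (_+ 1) (toℕ-fromℕ N)) (+-comm N 1)
      complete : ∀ v → v ∈ tabulate f
      complete v = subst (_∈ tabulate f) (proj₂ (Bijection.surjective W v) refl)
                         (∈-tabulate⁺ {f = f} (proj₁ (Bijection.surjective W v)))

module DoubleCover {A C : Set} (φ : A ↔ C) where

  open Inverse φ using (to; from; strictlyInverseˡ)

  sheet : Bool → A → A ⊎ C
  sheet false = inj₁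
  sheet true  = inj₂ ∘ to

  sheets : List A → List (A ⊎ C)
  sheets xs = map (sheet false) xs ++ map (sheet true) xs

  sheets-eachOnce : ∀ {xs} → ListsEachOnce xs → ListsEachOnce (sheets xs)
  sheets-eachOnce {xs} (unique , complete) =
    Unique.++⁺ (Unique.map⁺ inj₁-injective unique)
               (Unique.map⁺ (Injection.injective (↔⇒↣ φ) ∘ inj₂-injective) unique)
               apart ,
    covered
    where
    apart : ∀ {z} → ¬ (z ∈ map (sheet false) xs × z ∈ map (sheet true) xs)
    apart (l , r) with ∈-map⁻ (sheet false) l | ∈-map⁻ (sheet true) r
    ... | _ , _ , refl | _ , _ , ()
    covered : ∀ z → z ∈ sheets xs
    covered (inj₁ x) = ∈-++⁺ˡ (∈-map⁺ (sheet false) (complete x))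
    covered (inj₂ y) = ∈-++⁺ʳ (map (sheet false) xs)
      (subst (λ c → inj₂ c ∈ map (sheet true) xs) (strictlyInverseˡ y)
             (∈-map⁺ (sheet true) (complete (from y))))

  zigzag : Bool → List A → List (A ⊎ C)
  zigzag b []       = []
  zigzag b (x ∷ xs) = sheet b x ∷ zigzag (not b) xs

  length-zigzag : ∀ b xs → length (zigzag b xs) ≡ length xs
  length-zigzag b []       = refl
  length-zigzag b (x ∷ xs) = cong suc (length-zigzag (not b) xs)

  zigzag-++ : ∀ b xs ys → zigzag b (xs ++ ys) ≡ zigzag b xs ++ zigzag (b xor oddLength xs) ys
  zigzag-++ b []       ys = cong (λ c → zigzag c ys) (sym (xor-identityʳ b))
  zigzag-++ b (x ∷ xs) ys = cong (sheet b x ∷_) (begin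
    zigzag (not b) (xs ++ ys)                                  ≡⟨ zigzag-++ (not b) xs ys ⟩
    zigzag (not b) xs ++ zigzag (not b xor oddLength xs) ys    ≡⟨ cong (λ c → zigzag (not b) xs ++ zigzag c ys) flip ⟩
    zigzag (not b) xs ++ zigzag (b xor not (oddLength xs)) ys  ∎)
    where
    open ≡-Reasoning
    flip : not b xor oddLength xs ≡ b xor not (oddLength xs)
    flip = trans (sym (not-distribˡ-xor b _)) (not-distribʳ-xor b _)

  zigzag-↭-sheets : ∀ b xs → zigzag b xs ++ zigzag (not b) xs ↭ sheets xs
  zigzag-↭-sheets b []       = ↭-refl
  zigzag-↭-sheets b (x ∷ xs) = begin
    sheet b x ∷ (zigzag (not b) xs ++ sheet (not b) x ∷ zigzag (not (not b)) xs)
      ↭⟨ prep _ (shift _ (zigzag (not b) xs) _) ⟩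
    sheet b x ∷ sheet (not b) x ∷ (zigzag (not b) xs ++ zigzag (not (not b)) xs)
      ↭⟨ prep _ (prep _ (zigzag-↭-sheets (not b) xs)) ⟩
    sheet b x ∷ sheet (not b) x ∷ sheets xs
      ↭⟨ both-sheets b ⟩
    sheet false x ∷ sheet true x ∷ sheets xs
      ↭⟨ prep _ (↭-sym (shift _ (map (sheet false) xs) _)) ⟩
    sheets (x ∷ xs) ∎
    where
    open PermutationReasoning
    both-sheets : ∀ b → sheet b x ∷ sheet (not b) x ∷ sheets xs ↭ sheet false x ∷ sheet true x ∷ sheets xs
    both-sheets false = ↭-refl
    both-sheets true  = swap _ _ ↭-refl

  zigzag-rotate : ∀ b xs ys → oddLength (xs ++ ys) ≡ false →
                  zigzag (b xor oddLength xs) (ys ++ xs) ↭ zigzag b (xs ++ ys)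
  zigzag-rotate b xs ys even = begin
    zigzag b′ (ys ++ xs)                           ≡⟨ zigzag-++ b′ ys xs ⟩
    zigzag b′ ys ++ zigzag (b′ xor oddLength ys) xs  ≡⟨ cong (λ c → zigzag b′ ys ++ zigzag c xs) full-turn ⟩
    zigzag b′ ys ++ zigzag b xs                    ↭⟨ ++-comm (zigzag b′ ys) _ ⟩
    zigzag b xs ++ zigzag b′ ys                    ≡⟨ zigzag-++ b xs ys ⟨
    zigzag b (xs ++ ys)                            ∎
    where
    open PermutationReasoning
    b′ = b xor oddLength xs
    full-turn : b′ xor oddLength ys ≡ b
    full-turn = trans (xor-assoc b _ _)
                      (trans (cong (b xor_) (trans (sym (oddLength-++ xs ys)) even)) (xor-identityʳ b))

  module Lift (D : A → A → Set) (E : A ⊎ C → A ⊎ C → Set)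
              (sheet-adj : ∀ b {x y} → D x y → E (sheet b x) (sheet (not b) y)) where

    zigzag-walk : ∀ b {x} xs → Walk D x xs → Walk E (sheet (not b) x) (zigzag b xs)
    zigzag-walk b     []       _       = tt
    zigzag-walk false (y ∷ ys) (r , w) = sheet-adj true r , zigzag-walk true ys w
    zigzag-walk true  (y ∷ ys) (r , w) = sheet-adj false r , zigzag-walk false ys w

    end-zigzag : ∀ b x xs → end (sheet (not b) x) (zigzag b xs) ≡ sheet (not (b xor oddLength xs)) (end x xs)
    end-zigzag false x []       = refl
    end-zigzag true  x []       = refl
    end-zigzag false x (y ∷ ys) = end-zigzag true y ys
    end-zigzag true  x (y ∷ ys) =
      trans (end-zigzag false y ys) (cong (λ c → sheet (not c) (end y ys)) (sym (not-involutive (oddLength ys))))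

    zigzag-closed : ∀ b {x} xs → ClosedWalk D x xs → oddLength xs ≡ false →
                    ClosedWalk E (sheet (not b) x) (zigzag b xs)
    zigzag-closed b {x} xs (w , back) even = zigzag-walk b xs w , (begin
      end (sheet (not b) x) (zigzag b xs)          ≡⟨ end-zigzag b x xs ⟩
      sheet (not (b xor oddLength xs)) (end x xs)  ≡⟨ cong₂ (λ c z → sheet (not (b xor c)) z) even back ⟩
      sheet (not (b xor false)) x                  ≡⟨ cong (λ c → sheet (not c) x) (xor-identityʳ b) ⟩
      sheet (not b) x                              ∎)
      where open ≡-Reasoning

    zigzag-rotation : ∀ b b′ {x} xs ys → b xor oddLength xs ≡ b′ →
                      ClosedWalk D x (xs ++ ys) → oddLength (xs ++ ys) ≡ false →
                      ClosedWalk E (sheet (not b′) (end x xs)) (zigzag b′ (ys ++ xs)) ×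
                      zigzag b′ (ys ++ xs) ↭ zigzag b (xs ++ ys)
    zigzag-rotation b _ xs ys refl cw even =
      zigzag-closed _ (ys ++ xs) (ClosedWalk-rotate xs ys cw) (trans (oddLength-comm ys xs) even) ,
      zigzag-rotate b xs ys even

    zigzag-twice : ∀ {x} xs → ClosedWalk D x xs → oddLength xs ≡ true →
                   ClosedWalk E (sheet true x) (zigzag false (xs ++ xs)) × zigzag false (xs ++ xs) ↭ sheets xs
    zigzag-twice xs cw odd =
      zigzag-closed false (xs ++ xs) (ClosedWalk-++ xs cw cw) (trans (oddLength-++ xs xs) (xor-same (oddLength xs))) ,
      (begin
        zigzag false (xs ++ xs)                        ≡⟨ zigzag-++ false xs xs ⟩
        zigzag false xs ++ zigzag (oddLength xs) xs    ≡⟨ cong (λ c → zigzag false xs ++ zigzag c xs) odd ⟩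
        zigzag false xs ++ zigzag true xs              ↭⟨ zigzag-↭-sheets false xs ⟩
        sheets xs                                      ∎)
      where open PermutationReasoning

    zigzag-ending-at : ∀ {x} xs a ys → ClosedWalk D x (xs ++ a ∷ ys) → oddLength (xs ++ a ∷ ys) ≡ false →
                       let L = ys ++ xs ++ [ a ] in
                       ClosedWalk E (sheet false a) (zigzag true L) ×
                       zigzag true L ↭ zigzag (oddLength xs) (xs ++ a ∷ ys)
    zigzag-ending-at {x} xs a ys cw even =
      subst (λ z → ClosedWalk E (sheet false z) (zigzag true L)) (end-++ x xs [ a ]) (proj₁ rotated) ,
      subst (λ K → zigzag true L ↭ zigzag (oddLength xs) K) (sym reassoc) (proj₂ rotated)
      where
      L = ys ++ xs ++ [ a ]
      reassoc : xs ++ a ∷ ys ≡ (xs ++ [ a ]) ++ ys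
      reassoc = sym (++-assoc xs [ a ] ys)
      last-flips : oddLength xs xor oddLength (xs ++ [ a ]) ≡ true
      last-flips = trans (cong (oddLength xs xor_) (oddLength-++ xs [ a ]))
                         (trans (sym (xor-assoc (oddLength xs) _ true)) (cong (_xor true) (xor-same (oddLength xs))))
      rotated = zigzag-rotation (oddLength xs) true (xs ++ [ a ]) ys last-flips
                  (subst (ClosedWalk D x) reassoc cw) (subst (λ K → oddLength K ≡ false) reassoc even)

    zigzag-starting-at : ∀ {x} us c vs → ClosedWalk D x (us ++ c ∷ vs) → oddLength (us ++ c ∷ vs) ≡ false →
                         Walk E (sheet true c) (zigzag false (vs ++ us)) ×
                         zigzag true (c ∷ vs ++ us) ↭ zigzag (not (oddLength us)) (us ++ c ∷ vs)
    zigzag-starting-at us c vs cw even = proj₂ (proj₁ (proj₁ rotated)) , proj₂ rotated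
      where rotated = zigzag-rotation (not (oddLength us)) true us (c ∷ vs) (xor-inverseˡ (oddLength us)) cw even

    -- For even K the zigzag through a on sheet false and the zigzag through c on sheet true are
    -- closed walks that together cover both sheets once; the edge a—c links them into a path.
    splicedPath : ∀ {x} K → ClosedWalk D x K → oddLength K ≡ false →
                  ∀ xs a ys us c vs → K ≡ xs ++ a ∷ ys → K ≡ us ++ c ∷ vs →
                  D a c → oddLength xs ≡ oddLength us →
                  Σ (List (A ⊎ C)) λ H → Walk E (sheet false a) H × H ↭ sheets K
    splicedPath K cw even xs a ys us c vs refl K≡ a—c same =
      first ++ second ,
      Walk-++⁺ first (proj₁ cw₁) (subst (λ z → Walk E z second) (sym (proj₂ cw₁)) (sheet-adj false a—c , w₂)) ,
      (begin
        first ++ second                                           ↭⟨ ++⁺ perm₁ perm₂ ⟩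
        zigzag (oddLength xs) K ++ zigzag (not (oddLength us)) (us ++ c ∷ vs)
          ≡⟨ cong₂ (λ b L → zigzag (oddLength xs) K ++ zigzag (not b) L) (sym same) (sym K≡) ⟩
        zigzag (oddLength xs) K ++ zigzag (not (oddLength xs)) K  ↭⟨ zigzag-↭-sheets _ K ⟩
        sheets K                                                  ∎)
      where
      open PermutationReasoning
      first   = zigzag true (ys ++ xs ++ [ a ])
      second  = zigzag true (c ∷ vs ++ us)
      ended   = zigzag-ending-at xs a ys cw even
      started = zigzag-starting-at us c vs (subst (ClosedWalk D _) K≡ cw) (subst (λ L → oddLength L ≡ false) K≡ even)
      cw₁     = proj₁ ended
      perm₁   = proj₂ ended
      w₂      = proj₁ started
      perm₂   = proj₂ started

    module _ (hc : HamiltonCycleList D) where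
      open HamiltonCycleList hc renaming (vertices to K)

      liftOddHamiltonCycle : oddLength K ≡ true → HamiltonCycleList E
      liftOddHamiltonCycle odd = record
        { anchor     = sheet true anchor
        ; vertices   = zigzag false (K ++ K)
        ; eachOnce   = ListsEachOnce-resp-↭ (↭-sym (proj₂ doubled)) (sheets-eachOnce eachOnce)
        ; closedWalk = proj₁ doubled
        ; three      = ≤-trans three (≤-trans (m≤m+n (length K) (length K))
                         (≤-reflexive (sym (trans (length-zigzag false (K ++ K)) (length-++ K)))))
        }
        where doubled = zigzag-twice K closedWalk odd

      liftEvenHamiltonCycle : NonBipartite D → oddLength K ≡ false → HamiltonPathList E
      liftEvenHamiltonCycle nonBipartite even = record
        { anchor   = sheet false a
        ; vertices = proj₁ spliced
        ; eachOnce = ListsEachOnce-resp-↭ (↭-sym (proj₂ (proj₂ spliced))) (sheets-eachOnce eachOnce)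
        ; walk     = proj₁ (proj₂ spliced)
        }
        where
        split : ∀ v → ∃₂ λ xs ys → K ≡ xs ++ v ∷ ys
        split v = ∈-∃++ (proj₂ eachOnce v)
        positionParity : A → Bool
        positionParity v = oddLength (proj₁ (split v))
        edge = nonBipartite positionParity
        a = proj₁ edge
        c = proj₁ (proj₂ edge)
        spliced = splicedPath K closedWalk even _ a _ _ c _ (proj₂ (proj₂ (split a))) (proj₂ (proj₂ (split c)))
                    (proj₁ (proj₂ (proj₂ edge))) (proj₂ (proj₂ (proj₂ edge)))

    liftHamiltonCycle : HamiltonCycleList D → NonBipartite D → HamiltonCycleList E ⊎ HamiltonPathList E
    liftHamiltonCycle hc nonBipartite with oddLength (HamiltonCycleList.vertices hc) in parity
    ... | true  = inj₁ (liftOddHamiltonCycle hc parity)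
    ... | false = inj₂ (liftEvenHamiltonCycle hc nonBipartite parity)

toSubset : ∀ n → (ℕ → Bool) → Subset n
toSubset zero    g = []
toSubset (suc n) g = g 0 ∷ toSubset n (g ∘ suc)

∈-toSubset : ∀ {n} g (x : Fin n) → x ∈ₛ toSubset n g → T (g (toℕ x))
∈-toSubset {suc n} g zero    x∈ = Equivalence.from T-≡ ([]=⇒lookup x∈)
∈-toSubset {suc n} g (suc x) x∈ = ∈-toSubset (g ∘ suc) x (drop-there x∈)

toSubset-Empty∩ : ∀ {n} g h → (∀ x → T (g x) → T (h x) → ⊥) → Empty (toSubset n g ∩ toSubset n h)
toSubset-Empty∩ {n} g h apart (x , x∈) =
  apart (toℕ x) (∈-toSubset g x (proj₁ both)) (∈-toSubset h x (proj₂ both))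
  where both = x∈p∩q⁻ (toSubset n g) (toSubset n h) x∈

∣toSubset-∨∣ : ∀ {n} g h → (∀ x → T (g x) → T (h x) → ⊥) →
               ∣ toSubset n (λ x → g x ∨ h x) ∣ ≡ ∣ toSubset n g ∣ + ∣ toSubset n h ∣
∣toSubset-∨∣ {zero}  g h apart = refl
∣toSubset-∨∣ {suc n} g h apart with g 0 in g0 | h 0 in h0
... | true  | true  = ⊥-elim (apart 0 (Equivalence.from T-≡ g0) (Equivalence.from T-≡ h0))
... | true  | false = cong suc (∣toSubset-∨∣ {n} (g ∘ suc) (h ∘ suc) (apart ∘ suc))
... | false | true  = trans (cong suc (∣toSubset-∨∣ {n} (g ∘ suc) (h ∘ suc) (apart ∘ suc))) (sym (+-suc _ _))
... | false | false = ∣toSubset-∨∣ {n} (g ∘ suc) (h ∘ suc) (apart ∘ suc)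

∣toSubset-<ᵇ∣ : ∀ {n b} → b ≤ n → ∣ toSubset n (_<ᵇ b) ∣ ≡ b
∣toSubset-<ᵇ∣ {zero}  {zero}  _       = refl
∣toSubset-<ᵇ∣ {suc n} {zero}  _       = ∣toSubset-<ᵇ∣ {n} z≤n
∣toSubset-<ᵇ∣ {suc n} {suc b} (s≤s h) = cong suc (∣toSubset-<ᵇ∣ h)

infixr 6 _∪_
infix  4 _∋_

data Region : Set where
  interval : ℕ → ℕ → Region
  _∪_      : Region → Region → Region

-- `interval a b` is [a, b); writing `not (x <ᵇ a)` rather than `a ≤ᵇ x` makes
-- `interval (suc a) (suc b) ∋ suc x` reduce to `interval a b ∋ x`.
_∋_ : Region → ℕ → Bool
interval a b ∋ x = not (x <ᵇ a) ∧ (x <ᵇ b)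
(r ∪ s)   ∋ x = (r ∋ x) ∨ (s ∋ x)

∋-interval⁻ : ∀ a b x → T (interval a b ∋ x) → a ≤ x × x < b
∋-interval⁻ a b x inside with x <ᵇ a in below
... | false = ≮⇒≥ (λ x<a → subst T below (<⇒<ᵇ x<a)) , <ᵇ⇒< x b inside
... | true  = ⊥-elim inside

∣toSubset-interval∣ : ∀ {n a b} → a ≤ b → b ≤ n → ∣ toSubset n (interval a b ∋_) ∣ ≡ b ∸ a
∣toSubset-interval∣ {a = zero}              _         b≤n       = ∣toSubset-<ᵇ∣ b≤n
∣toSubset-interval∣ {suc n} {suc a} {suc b} (s≤s a≤b) (s≤s b≤n) = ∣toSubset-interval∣ a≤b b≤n

data Disjoint : Region → Region → Set where
  before : ∀ {a b c d} → b ≤ c → Disjoint (interval a b) (interval c d)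
  after  : ∀ {a b c d} → d ≤ a → Disjoint (interval a b) (interval c d)
  ∪ˡ     : ∀ {r₁ r₂ s} → Disjoint r₁ s → Disjoint r₂ s → Disjoint (r₁ ∪ r₂) s
  ∪ʳ     : ∀ {r s₁ s₂} → Disjoint r s₁ → Disjoint r s₂ → Disjoint r (s₁ ∪ s₂)

Disjoint-sound : ∀ {r s} → Disjoint r s → ∀ x → T (r ∋ x) → T (s ∋ x) → ⊥
Disjoint-sound (before {a} {b} {c} {d} b≤c) x in₁ in₂ =
  <⇒≱ (proj₂ (∋-interval⁻ a b x in₁)) (≤-trans b≤c (proj₁ (∋-interval⁻ c d x in₂)))
Disjoint-sound (after {a} {b} {c} {d} d≤a) x in₁ in₂ =
  <⇒≱ (proj₂ (∋-interval⁻ c d x in₂)) (≤-trans d≤a (proj₁ (∋-interval⁻ a b x in₁)))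
Disjoint-sound (∪ˡ apart₁ apart₂) x in₁₂ in₀ =
  Sum.[ (λ in₁ → Disjoint-sound apart₁ x in₁ in₀) , (λ in₂ → Disjoint-sound apart₂ x in₂ in₀) ]
      (Equivalence.to T-∨ in₁₂)
Disjoint-sound (∪ʳ apart₁ apart₂) x in₀ in₁₂ =
  Sum.[ Disjoint-sound apart₁ x in₀ , Disjoint-sound apart₂ x in₀ ] (Equivalence.to T-∨ in₁₂)

∣toSubset-∪∣ : ∀ {n r s} → Disjoint r s → ∣ toSubset n (r ∪ s ∋_) ∣ ≡ ∣ toSubset n (r ∋_) ∣ + ∣ toSubset n (s ∋_) ∣
∣toSubset-∪∣ {n} {r} {s} apart = ∣toSubset-∨∣ {n} (r ∋_) (s ∋_) (Disjoint-sound apart)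

toSubset-disjoint : ∀ {n r s} → Disjoint r s → Empty (toSubset n (r ∋_) ∩ toSubset n (s ∋_))
toSubset-disjoint {r = r} {s} apart = toSubset-Empty∩ (r ∋_) (s ∋_) (Disjoint-sound apart)

KSet-≡ : ∀ {n k} {x y : KSet n k} → proj₁ x ≡ proj₁ y → x ≡ y
KSet-≡ {x = A , p} {y = .A , q} refl = cong (A ,_) (≡-irrelevant p q)

∁-involutive : ∀ {n} (p : Subset n) → ∁ (∁ p) ≡ p
∁-involutive p = trans (sym (map-∘ not not p)) (trans (map-cong not-involutive p) (map-id p))

complement : ∀ {n k} → k ≤ n → KSet n k ↔ KSet n (n ∸ k)
complement {n} {k} k≤n =
  mk↔ₛ′ to from (λ y → KSet-≡ (∁-involutive (proj₁ y))) (λ x → KSet-≡ (∁-involutive (proj₁ x)))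
  where
  to : KSet n k → KSet n (n ∸ k)
  to (A , ∣A∣) = ∁ A , trans (∣∁p∣≡n∸∣p∣ A) (cong (n ∸_) ∣A∣)
  from : KSet n (n ∸ k) → KSet n k
  from (B , ∣B∣) = ∁ B , trans (∣∁p∣≡n∸∣p∣ B) (trans (cong (n ∸_) ∣B∣) (m∸[m∸n]≡n k≤n))

Empty∩⇒⊆∁ : ∀ {n} {p q : Subset n} → Empty (p ∩ q) → p ⊆ ∁ q
Empty∩⇒⊆∁ apart x∈p = x∉p⇒x∈∁p (λ x∈q → apart (_ , x∈p∩q⁺ (x∈p , x∈q)))

module _ {n k : ℕ} (k≤n : k ≤ n) where
  open DoubleCover (complement k≤n)

  bipKneser-sheet-adj : ∀ b {x y} → Adj (Kneser n k) x y → Adj (BipKneser n k) (sheet b x) (sheet (not b) y)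
  bipKneser-sheet-adj false         apart = Empty∩⇒⊆∁ apart
  bipKneser-sheet-adj true  {x} {y} apart = Empty∩⇒⊆∁ (subst Empty (∩-comm (proj₁ x) (proj₁ y)) apart)

module KneserOddCycle (n k : ℕ) (2k+1≤n : suc (k + k) ≤ n) where

  k≤n : k ≤ n
  k≤n = ≤-trans (m≤m+n k k) (≤-trans (n≤1+n _) 2k+1≤n)

  -- P k, Q (k-1), P (k-1), …, Q 0, P 0 is a walk, and P 0 is disjoint from P k:
  -- a closed walk of odd length 2k+1.
  P-region Q-region : ℕ → Region
  P-region u = interval 0 u ∪ interval (suc (k + u)) (suc (k + k))
  Q-region u = interval (suc u) (suc (u + k))

  P : ∀ u → u ≤ k → KSet n k
  P u u≤k = toSubset n (P-region u ∋_) , (begin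
    ∣ toSubset n (P-region u ∋_) ∣
      ≡⟨ ∣toSubset-∪∣ {n} {interval 0 u} {interval (suc (k + u)) (suc (k + k))}
                     (before (≤-trans (n≤1+n u) (s≤s (m≤n+m u k)))) ⟩
    ∣ toSubset n (interval 0 u ∋_) ∣ + ∣ toSubset n (interval (suc (k + u)) (suc (k + k)) ∋_) ∣
      ≡⟨ cong₂ _+_ (∣toSubset-interval∣ z≤n (≤-trans u≤k k≤n))
                   (∣toSubset-interval∣ (s≤s (+-monoʳ-≤ k u≤k)) 2k+1≤n) ⟩
    u + ((k + k) ∸ (k + u))  ≡⟨ cong (u +_) ([m+n]∸[m+o]≡n∸o k k u) ⟩
    u + (k ∸ u)              ≡⟨ m+[n∸m]≡n u≤k ⟩
    k                        ∎)
    where open ≡-Reasoning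

  Q : ∀ u → u ≤ k → KSet n k
  Q u u≤k = toSubset n (Q-region u ∋_) ,
    trans (∣toSubset-interval∣ (s≤s (m≤m+n u k)) (≤-trans (s≤s (+-monoˡ-≤ k u≤k)) 2k+1≤n)) (m+n∸m≡n u k)

  P₀-Pₖ : Disjoint (P-region 0) (P-region k)
  P₀-Pₖ = ∪ˡ (∪ʳ (before z≤n) (before z≤n))
             (∪ʳ (after (≤-trans (m≤m+n k 0) (n≤1+n _))) (before ≤-refl))

  P-Q : ∀ u → Disjoint (P-region (suc u)) (Q-region u)
  P-Q u = ∪ˡ (before ≤-refl) (after (s≤s (≤-trans (≤-reflexive (+-comm u k)) (+-monoʳ-≤ k (n≤1+n u)))))

  Q-P : ∀ u → Disjoint (Q-region u) (P-region u)
  Q-P u = ∪ʳ (after (n≤1+n u)) (before (≤-reflexive (cong suc (+-comm u k))))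

  descent : ∀ u → u ≤ k → List (KSet n k)
  descent zero    _   = []
  descent (suc u) u<k = Q u (<⇒≤ u<k) ∷ P u (<⇒≤ u<k) ∷ descent u (<⇒≤ u<k)

  descent-walk : ∀ u u≤k → Walk (Adj (Kneser n k)) (P u u≤k) (descent u u≤k)
  descent-walk zero    _   = tt
  descent-walk (suc u) u<k =
    toSubset-disjoint (P-Q u) , toSubset-disjoint (Q-P u) , descent-walk u (<⇒≤ u<k)

  descent-end : ∀ u u≤k → end (P u u≤k) (descent u u≤k) ≡ P 0 z≤n
  descent-end zero    z≤n = refl
  descent-end (suc u) u<k = descent-end u (<⇒≤ u<k)

  descent-even : ∀ u u≤k → oddLength (descent u u≤k) ≡ false
  descent-even zero    _   = refl
  descent-even (suc u) u<k = trans (not-involutive _) (descent-even u (<⇒≤ u<k))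

  kneser-nonBipartite : NonBipartite (Adj (Kneser n k))
  kneser-nonBipartite =
    oddClosedWalk⇒nonBipartite (P k ≤-refl ∷ descent k ≤-refl)
      ((toSubset-disjoint P₀-Pₖ , descent-walk k ≤-refl) , descent-end k ≤-refl)
      (cong not (descent-even k ≤-refl))

lemma4 : (n k : ℕ) → 1 ≤ k → 2 * k + 1 ≤ n →
         HamiltonCycle (Kneser n k) →
         HamiltonCycle (BipKneser n k) ⊎ HamiltonPath (BipKneser n k)
lemma4 n k _ 2k+1≤n hamiltonian =
  Sum.map (toHamiltonCycle (BipKneser n k)) (toHamiltonPath (BipKneser n k))
          (liftHamiltonCycle (fromHamiltonCycle (Kneser n k) hamiltonian) kneser-nonBipartite)
  where
  2k+1≡ : 2 * k + 1 ≡ suc (k + k)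
  2k+1≡ = trans (+-comm (2 * k) 1) (cong (λ m → suc (k + m)) (+-identityʳ k))
  open KneserOddCycle n k (subst (_≤ n) 2k+1≡ 2k+1≤n) using (k≤n; kneser-nonBipartite)
  open DoubleCover (complement k≤n) using (module Lift)
  open Lift (Adj (Kneser n k)) (Adj (BipKneser n k)) (bipKneser-sheet-adj k≤n) using (liftHamiltonCycle)
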